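{- The set $\{u\in\mathbb{YF}:\ u \text{ does not begin with the letter } 1\}$ is first-order definable in $\mathbf{YF}^*=\langle\mathbb{YF},\geqslant,2\rangle$.
   Context: $\mathbb{YF}$ is the set of all finite words (including the empty word $\varepsilon$, which does not begin with $1$) over $\{1,2\}$. For a word $v$, $\#v$ is its length and $d(v)$ the number of letters $2$. Order: write $x=x'w$, $y=y'w$ with $w$ the longest common suffix; then $y\geqslant x$ iff $d(y')\geqslant\#x'$. $\mathbf{YF}^*$ is this partial order with an added constant symbol interpreted as the word $2$. A set is first-order definable if there is a first-order formula in the language $\{\geqslant,2\}$ whose set of satisfying elements is exactly that set. -}

module Defs where

open import Data.Nat using (ℕ; zero; suc; _≤_)
open import Data.List using (List; []; _∷_; length; reverse)
open import Data.Fin using (Fin)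
open import Data.Vec using (Vec; lookup)
open import Data.Product using (_×_; _,_)
open import Data.Empty using (⊥)
open import Relation.Nullary using (¬_)
open import Relation.Binary.PropositionalEquality using (_≡_)

data Letter : Set where
  𝟏 𝟐 : Letter

YF : Set
YF = List Letter

d : YF → ℕ
d []       = 0
d (𝟏 ∷ v) = d v
d (𝟐 ∷ v) = suc (d v)

stripCommonPrefix : YF → YF → YF × YF
stripCommonPrefix (𝟏 ∷ x) (𝟏 ∷ y) = stripCommonPrefix x y
stripCommonPrefix (𝟐 ∷ x) (𝟐 ∷ y) = stripCommonPrefix x y
stripCommonPrefix x y = x , y

-- Strip the longest common suffix w: x = x' w, y = y' w  ↦  (x' , y')
-- (computed via reversal; the returned words are x', y' reversed, which
-- does not affect lengths or numbers of 2's).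
stripCommonSuffix : YF → YF → YF × YF
stripCommonSuffix x y = stripCommonPrefix (reverse x) (reverse y)

_⊒_ : YF → YF → Set
y ⊒ x with stripCommonSuffix x y
... | x' , y' = length x' ≤ d y'

two : YF
two = 𝟐 ∷ []

BeginsWith1 : YF → Set
BeginsWith1 []      = ⊥
BeginsWith1 (a ∷ _) = a ≡ 𝟏

-- First-order logic in the language {≥, 2} (with equality),
-- formulas with n free variables (de Bruijn indices).

data Term (n : ℕ) : Set where
  var : Fin n → Term n
  c2  : Term n

data Formula : ℕ → Set where
  _≐_  : ∀ {n} → Term n → Term n → Formula n
  _≽_  : ∀ {n} → Term n → Term n → Formula n
  ⊥'   : ∀ {n} → Formula n
  ¬'_  : ∀ {n} → Formula n → Formula n
  _∧'_ : ∀ {n} → Formula n → Formula n → Formula n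
  _∨'_ : ∀ {n} → Formula n → Formula n → Formula n
  _⇒'_ : ∀ {n} → Formula n → Formula n → Formula n
  ∀'   : ∀ {n} → Formula (suc n) → Formula n
  ∃'   : ∀ {n} → Formula (suc n) → Formula n

⟦_⟧t : ∀ {n} → Term n → Vec YF n → YF
⟦ var i ⟧t ρ = lookup ρ i
⟦ c2 ⟧t    ρ = two

-- Classical (Tarskian) satisfaction, rendered constructively via the
-- Gödel–Gentzen negative translation: ∨ and ∃ are read as ¬(¬∧¬) and ¬∀¬.
Sat : ∀ {n} → Formula n → Vec YF n → Set
Sat (s ≐ t)   ρ = ¬ ¬ (⟦ s ⟧t ρ ≡ ⟦ t ⟧t ρ)
Sat (s ≽ t)   ρ = ¬ ¬ (⟦ s ⟧t ρ ⊒ ⟦ t ⟧t ρ)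
Sat ⊥'        ρ = ⊥
Sat (¬' φ)    ρ = ¬ Sat φ ρ
Sat (φ ∧' ψ)  ρ = Sat φ ρ × Sat ψ ρ
Sat (φ ∨' ψ)  ρ = ¬ (¬ Sat φ ρ × ¬ Sat ψ ρ)
Sat (φ ⇒' ψ)  ρ = Sat φ ρ → Sat ψ ρ
Sat (∀' φ)    ρ = (u : YF) → Sat φ (u Data.Vec.∷ ρ)
Sat (∃' φ)    ρ = ¬ ((u : YF) → ¬ Sat φ (u Data.Vec.∷ ρ))

FODefinable : (YF → Set) → Set
FODefinable S = Data.Product.Σ (Formula 1) λ φ →
  (u : YF) → (Sat φ (u Data.Vec.∷ Data.Vec.[]) → S u) × (S u → Sat φ (u Data.Vec.∷ Data.Vec.[]))

-- A word u has a greatest element strictly below it exactly when u begins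
-- with 1 (then it is the tail of u) or u = 2 (then it is 1).  Indeed, the
-- words below 1v are those below v, while below 2av there are both 1av and
-- a word not below 1av (2v if a = 1, 21v if a = 2); since the order is graded
-- by the digit sum, nothing lies strictly between 1av and 2av, so 2av has no
-- greatest element below it.  Hence u does not begin with 1 iff
-- "u = 2, or u has no greatest element strictly below it".
module Submission where

open import Defs
open import Relation.Nullary using (¬_; contradiction)

open import Data.Nat using (ℕ; suc; _+_; _≤_; _<_; _≤?_; z≤n; s≤s)
open import Data.Nat.Properties
  using (≤-trans; ≤-reflexive; +-mono-≤; +-monoʳ-≤; +-suc; +-comm; n≤1+n; m≤n⇒m≤1+n; <⇒≱; module ≤-Reasoning)
open import Data.List using ([]; _∷_; _++_; _∷ʳ_; length; reverse)
open import Data.List.Properties using (unfold-reverse; reverse-++; reverse-injective)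
open import Data.Product using (_×_; _,_; ∃-syntax)
open import Data.Sum using (_⊎_; inj₁; inj₂; [_,_]′) renaming (map to ⊎-map)
open import Data.Empty using (⊥-elim)
open import Data.Fin using (zero; suc)
open import Data.Vec using ([]; _∷_)
open import Function using (id; _∘_; case_of_)
open import Relation.Nullary.Negation using (negated-stable)
open import Relation.Nullary.Decidable using (Dec; decidable-stable)
open import Relation.Binary.PropositionalEquality
  using (_≡_; _≢_; refl; sym; trans; cong; cong₂; subst; subst₂; module ≡-Reasoning)

Dominated : YF × YF → Set
Dominated (x' , y') = length x' ≤ d y'

-- On reversed words the common suffix becomes the common prefix, which is
-- what stripCommonPrefix removes:  y ⊒ x  is  reverse x ≼ reverse y.
_≼_ : YF → YF → Set
a ≼ b = Dominated (stripCommonPrefix a b)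

⊒≡≼-reverse : ∀ x y → (y ⊒ x) ≡ (reverse x ≼ reverse y)
⊒≡≼-reverse x y with stripCommonSuffix x y
... | _ , _ = refl

⊒⇒≼ : ∀ {x y} → y ⊒ x → reverse x ≼ reverse y
⊒⇒≼ {x} {y} = subst id (⊒≡≼-reverse x y)

≼⇒⊒ : ∀ {x y} → reverse x ≼ reverse y → y ⊒ x
≼⇒⊒ {x} {y} = subst id (sym (⊒≡≼-reverse x y))

stripCommonPrefix-++ : ∀ c a b → stripCommonPrefix (c ++ a) (c ++ b) ≡ stripCommonPrefix a b
stripCommonPrefix-++ []      a b = refl
stripCommonPrefix-++ (𝟏 ∷ c) a b = stripCommonPrefix-++ c a b
stripCommonPrefix-++ (𝟐 ∷ c) a b = stripCommonPrefix-++ c a b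

⊒-cancelʳ-++ : ∀ w x y → ((y ++ w) ⊒ (x ++ w)) ≡ (y ⊒ x)
⊒-cancelʳ-++ w x y = begin
  ((y ++ w) ⊒ (x ++ w))                               ≡⟨ ⊒≡≼-reverse (x ++ w) (y ++ w) ⟩
  reverse (x ++ w) ≼ reverse (y ++ w)                 ≡⟨ cong₂ _≼_ (reverse-++ x w) (reverse-++ y w) ⟩
  (reverse w ++ reverse x) ≼ (reverse w ++ reverse y) ≡⟨ cong Dominated (stripCommonPrefix-++ (reverse w) _ _) ⟩
  reverse x ≼ reverse y                               ≡⟨ sym (⊒≡≼-reverse x y) ⟩
  (y ⊒ x)                                             ∎
  where open ≡-Reasoning

⊒-++ʳ : ∀ w {x y} → y ⊒ x → (y ++ w) ⊒ (x ++ w)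
⊒-++ʳ w {x} {y} = subst id (sym (⊒-cancelʳ-++ w x y))

⊒-++ʳ⁻ : ∀ w {x y} → (y ++ w) ⊒ (x ++ w) → y ⊒ x
⊒-++ʳ⁻ w {x} {y} = subst id (⊒-cancelʳ-++ w x y)

_⊒?_ : ∀ y x → Dec (y ⊒ x)
y ⊒? x with stripCommonSuffix x y
... | x' , y' = length x' ≤? d y'

_⊐_ : YF → YF → Set
y ⊐ x = y ⊒ x × x ≢ y

rank : YF → ℕ
rank []      = 0
rank (𝟏 ∷ x) = suc (rank x)
rank (𝟐 ∷ x) = suc (suc (rank x))

rank-++ : ∀ x y → rank (x ++ y) ≡ rank x + rank y
rank-++ []      y = refl
rank-++ (𝟏 ∷ x) y = cong suc (rank-++ x y)
rank-++ (𝟐 ∷ x) y = cong (λ n → suc (suc n)) (rank-++ x y)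

rank-reverse : ∀ x → rank (reverse x) ≡ rank x
rank-reverse []      = refl
rank-reverse (c ∷ x) = begin
  rank (reverse (c ∷ x))          ≡⟨ cong rank (unfold-reverse c x) ⟩
  rank (reverse x ∷ʳ c)           ≡⟨ rank-++ (reverse x) (c ∷ []) ⟩
  rank (reverse x) + rank (c ∷ []) ≡⟨ cong (_+ rank (c ∷ [])) (rank-reverse x) ⟩
  rank x + rank (c ∷ [])          ≡⟨ +-comm (rank x) _ ⟩
  rank (c ∷ []) + rank x          ≡⟨ sym (rank-++ (c ∷ []) x) ⟩
  rank (c ∷ x)                    ∎
  where open ≡-Reasoning

rank≤length+length : ∀ x → rank x ≤ length x + length x
rank≤length+length []      = z≤n
rank≤length+length (𝟏 ∷ x) =
  s≤s (≤-trans (rank≤length+length x) (+-monoʳ-≤ (length x) (n≤1+n (length x))))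
rank≤length+length (𝟐 ∷ x) =
  s≤s (≤-trans (s≤s (rank≤length+length x)) (≤-reflexive (sym (+-suc (length x) (length x)))))

d+d≤rank : ∀ x → d x + d x ≤ rank x
d+d≤rank []      = z≤n
d+d≤rank (𝟏 ∷ x) = m≤n⇒m≤1+n (d+d≤rank x)
d+d≤rank (𝟐 ∷ x) = s≤s (≤-trans (≤-reflexive (+-suc (d x) (d x))) (s≤s (d+d≤rank x)))

length≤d⇒rank≤rank : ∀ {a b} → length a ≤ d b → rank a ≤ rank b
length≤d⇒rank≤rank {a} {b} h = begin
  rank a                ≤⟨ rank≤length+length a ⟩
  length a + length a   ≤⟨ +-mono-≤ h h ⟩
  d b + d b             ≤⟨ d+d≤rank b ⟩
  rank b                ∎
  where open ≤-Reasoning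

≼⇒≡⊎rank< : ∀ a b → a ≼ b → a ≡ b ⊎ rank a < rank b
≼⇒≡⊎rank< []      []      _ = inj₁ refl
≼⇒≡⊎rank< []      (𝟏 ∷ b) _ = inj₂ (s≤s z≤n)
≼⇒≡⊎rank< []      (𝟐 ∷ b) _ = inj₂ (s≤s z≤n)
≼⇒≡⊎rank< (𝟏 ∷ a) []      ()
≼⇒≡⊎rank< (𝟐 ∷ a) []      ()
≼⇒≡⊎rank< (𝟏 ∷ a) (𝟏 ∷ b) h = ⊎-map (cong (𝟏 ∷_)) s≤s (≼⇒≡⊎rank< a b h)
≼⇒≡⊎rank< (𝟐 ∷ a) (𝟐 ∷ b) h = ⊎-map (cong (𝟐 ∷_)) (s≤s ∘ s≤s) (≼⇒≡⊎rank< a b h)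
≼⇒≡⊎rank< (𝟏 ∷ a) (𝟐 ∷ b) (s≤s h) = inj₂ (s≤s (s≤s (length≤d⇒rank≤rank {a} {b} h)))
≼⇒≡⊎rank< (𝟐 ∷ a) (𝟏 ∷ b) h       = inj₂ (s≤s (length≤d⇒rank≤rank {𝟐 ∷ a} {b} h))

⊒⇒≡⊎rank< : ∀ {x y} → y ⊒ x → x ≡ y ⊎ rank x < rank y
⊒⇒≡⊎rank< {x} {y} h =
  ⊎-map reverse-injective (subst₂ _<_ (rank-reverse x) (rank-reverse y))
          (≼⇒≡⊎rank< (reverse x) (reverse y) (⊒⇒≼ {x} {y} h))

⊐⇒rank< : ∀ {x y} → y ⊐ x → rank x < rank y
⊐⇒rank< (h , x≢y) = [ ⊥-elim ∘ x≢y , id ]′ (⊒⇒≡⊎rank< h)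

d-∷ʳ𝟏 : ∀ b → d (b ∷ʳ 𝟏) ≡ d b
d-∷ʳ𝟏 []      = refl
d-∷ʳ𝟏 (𝟏 ∷ b) = d-∷ʳ𝟏 b
d-∷ʳ𝟏 (𝟐 ∷ b) = cong suc (d-∷ʳ𝟏 b)

≼∷ʳ𝟏⇒≼ : ∀ a b → a ≼ (b ∷ʳ 𝟏) → a ≢ b ∷ʳ 𝟏 → a ≼ b
≼∷ʳ𝟏⇒≼ []          b       _ _   = z≤n
≼∷ʳ𝟏⇒≼ (𝟏 ∷ [])    []      _ a≢  = contradiction refl a≢
≼∷ʳ𝟏⇒≼ (𝟏 ∷ 𝟏 ∷ _) []      () _
≼∷ʳ𝟏⇒≼ (𝟏 ∷ 𝟐 ∷ _) []      () _
≼∷ʳ𝟏⇒≼ (𝟐 ∷ _)     []      () _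
≼∷ʳ𝟏⇒≼ (𝟏 ∷ a)     (𝟏 ∷ b) h a≢  = ≼∷ʳ𝟏⇒≼ a b h (a≢ ∘ cong (𝟏 ∷_))
≼∷ʳ𝟏⇒≼ (𝟐 ∷ a)     (𝟐 ∷ b) h a≢  = ≼∷ʳ𝟏⇒≼ a b h (a≢ ∘ cong (𝟐 ∷_))
≼∷ʳ𝟏⇒≼ (𝟏 ∷ a)     (𝟐 ∷ b) h _   = subst (λ k → suc (length a) ≤ suc k) (d-∷ʳ𝟏 b) h
≼∷ʳ𝟏⇒≼ (𝟐 ∷ a)     (𝟏 ∷ b) h _   = subst (λ k → suc (length a) ≤ k) (d-∷ʳ𝟏 b) h

𝟏∷⊐⇒⊒ : ∀ {v w} → (𝟏 ∷ v) ⊐ w → v ⊒ w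
𝟏∷⊐⇒⊒ {v} {w} (h , w≢) = ≼⇒⊒ {w} {v} (≼∷ʳ𝟏⇒≼ (reverse w) (reverse v) h′ w≢′)
  where
  h′ : reverse w ≼ (reverse v ∷ʳ 𝟏)
  h′ = subst (reverse w ≼_) (unfold-reverse 𝟏 v) (⊒⇒≼ {w} {𝟏 ∷ v} h)
  w≢′ : reverse w ≢ reverse v ∷ʳ 𝟏
  w≢′ e = w≢ (reverse-injective (trans e (sym (unfold-reverse 𝟏 v))))

𝟏∷⊐ : ∀ v → (𝟏 ∷ v) ⊐ v
𝟏∷⊐ v = ⊒-++ʳ v {[]} {𝟏 ∷ []} z≤n , λ ()

𝟐∷⊐𝟏∷ : ∀ v → (𝟐 ∷ v) ⊐ (𝟏 ∷ v)
𝟐∷⊐𝟏∷ v = ⊒-++ʳ v {𝟏 ∷ []} {𝟐 ∷ []} (s≤s z≤n) , λ ()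

𝟏∷⊑⊏𝟐∷⇒≡ : ∀ {v p} → p ⊒ (𝟏 ∷ v) → (𝟐 ∷ v) ⊐ p → 𝟏 ∷ v ≡ p
𝟏∷⊑⊏𝟐∷⇒≡ p⊒ ⊐p = [ id , (λ r → ⊥-elim (<⇒≱ (⊐⇒rank< ⊐p) r)) ]′ (⊒⇒≡⊎rank< p⊒)

-- Cancelling the common suffix v reduces each comparison to one between
-- short closed words, which evaluates.
𝟏∷∷-not-above-⊏𝟐∷∷ : ∀ a v → ∃[ w ] (𝟐 ∷ a ∷ v) ⊐ w × ¬ ((𝟏 ∷ a ∷ v) ⊒ w)
𝟏∷∷-not-above-⊏𝟐∷∷ 𝟏 v =
  𝟐 ∷ v , (⊒-++ʳ v {𝟐 ∷ []} {𝟐 ∷ 𝟏 ∷ []} (s≤s z≤n) , λ ()) ,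
  λ h → case ⊒-++ʳ⁻ v {𝟐 ∷ []} {𝟏 ∷ 𝟏 ∷ []} h of λ ()
𝟏∷∷-not-above-⊏𝟐∷∷ 𝟐 v =
  𝟐 ∷ 𝟏 ∷ v , (⊒-++ʳ v {𝟐 ∷ 𝟏 ∷ []} {𝟐 ∷ 𝟐 ∷ []} (s≤s (s≤s z≤n)) , λ ()) ,
  λ h → case ⊒-++ʳ⁻ v {𝟐 ∷ 𝟏 ∷ []} {𝟏 ∷ 𝟐 ∷ []} h of λ { (s≤s ()) }

GreatestBelow : YF → YF → Set
GreatestBelow u v = u ⊐ v × (∀ w → u ⊐ w → v ⊒ w)

greatestBelow-𝟏∷ : ∀ v → GreatestBelow (𝟏 ∷ v) v
greatestBelow-𝟏∷ v = 𝟏∷⊐ v , λ _ → 𝟏∷⊐⇒⊒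

¬greatestBelow-[] : ∀ v → ¬ GreatestBelow [] v
¬greatestBelow-[] v ([]⊐v , _) with ⊐⇒rank< {v} {[]} []⊐v
... | ()

¬greatestBelow-𝟐∷∷ : ∀ a v p → ¬ GreatestBelow (𝟐 ∷ a ∷ v) p
¬greatestBelow-𝟐∷∷ a v p (⊐p , greatest) with 𝟏∷∷-not-above-⊏𝟐∷∷ a v
... | w , ⊐w , ¬𝟏∷∷⊒w = ¬𝟏∷∷⊒w (subst (_⊒ w) (sym 𝟏∷∷≡p) (greatest w ⊐w))
  where
  𝟏∷∷≡p : 𝟏 ∷ a ∷ v ≡ p
  𝟏∷∷≡p = 𝟏∷⊑⊏𝟐∷⇒≡ (greatest (𝟏 ∷ a ∷ v) (𝟐∷⊐𝟏∷ (a ∷ v))) ⊐p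

greatestBelow⇒beginsWith1⊎two : ∀ {u v} → GreatestBelow u v → BeginsWith1 u ⊎ u ≡ two
greatestBelow⇒beginsWith1⊎two {[]}         {v} g = ⊥-elim (¬greatestBelow-[] v g)
greatestBelow⇒beginsWith1⊎two {𝟏 ∷ _}          _ = inj₁ refl
greatestBelow⇒beginsWith1⊎two {𝟐 ∷ []}         _ = inj₂ refl
greatestBelow⇒beginsWith1⊎two {𝟐 ∷ a ∷ u} {v} g = ⊥-elim (¬greatestBelow-𝟐∷∷ a u v g)

_≻'_ : ∀ {n} → Term n → Term n → Formula n
s ≻' t = (s ≽ t) ∧' (¬' (t ≐ s))

sat-≻⇒⊐ : ∀ {n} (s t : Term n) ρ → Sat (s ≻' t) ρ → ⟦ s ⟧t ρ ⊐ ⟦ t ⟧t ρ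
sat-≻⇒⊐ s t ρ (s⊒t , t≢s) = decidable-stable (⟦ s ⟧t ρ ⊒? ⟦ t ⟧t ρ) s⊒t , negated-stable t≢s

⊐⇒sat-≻ : ∀ {n} (s t : Term n) ρ → ⟦ s ⟧t ρ ⊐ ⟦ t ⟧t ρ → Sat (s ≻' t) ρ
⊐⇒sat-≻ s t ρ (s⊒t , t≢s) = (λ ¬s⊒t → ¬s⊒t s⊒t) , (λ ¬t≢s → ¬t≢s t≢s)

-- Free variables: 0 ↦ v, 1 ↦ u; under the quantifier 0 ↦ w.
greatestBelowφ : Formula 2
greatestBelowφ = (var (suc zero) ≻' var zero)
              ∧' (∀' ((var (suc (suc zero)) ≻' var zero) ⇒' (var (suc zero) ≽ var zero)))

greatestBelow⇒sat : ∀ u v → GreatestBelow u v → Sat greatestBelowφ (v ∷ u ∷ [])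
greatestBelow⇒sat u v (u⊐v , greatest) =
  ⊐⇒sat-≻ (var (suc zero)) (var zero) (v ∷ u ∷ []) u⊐v ,
  λ w sat ¬v⊒w → ¬v⊒w (greatest w (sat-≻⇒⊐ (var (suc (suc zero))) (var zero) (w ∷ v ∷ u ∷ []) sat))

sat⇒greatestBelow : ∀ u v → Sat greatestBelowφ (v ∷ u ∷ []) → GreatestBelow u v
sat⇒greatestBelow u v (sat , greatest) =
  sat-≻⇒⊐ (var (suc zero)) (var zero) (v ∷ u ∷ []) sat ,
  λ w u⊐w → decidable-stable (v ⊒? w)
              (greatest w (⊐⇒sat-≻ (var (suc (suc zero))) (var zero) (w ∷ v ∷ u ∷ []) u⊐w))

notBeginsWith1φ : Formula 1
notBeginsWith1φ = (var zero ≐ c2) ∨' (¬' (∃' greatestBelowφ))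

mainTheorem17 : FODefinable (λ u → ¬ BeginsWith1 u)
mainTheorem17 = notBeginsWith1φ , λ u → sound u , complete u
  where
  sound : ∀ u → Sat notBeginsWith1φ (u ∷ []) → ¬ BeginsWith1 u
  sound (𝟏 ∷ v) sat refl =
    sat ((λ ¬≢two → ¬≢two λ ()) ,
         (λ ¬∃ → ¬∃ λ ∀¬ → ∀¬ v (greatestBelow⇒sat (𝟏 ∷ v) v (greatestBelow-𝟏∷ v))))

  complete : ∀ u → ¬ BeginsWith1 u → Sat notBeginsWith1φ (u ∷ [])
  complete u ¬b1 (¬two , ¬¬∃) = ¬¬∃ λ ∃g → ∃g λ v sat →
    [ ¬b1 , (λ u≡two → ¬two (λ u≢two → u≢two u≡two)) ]′
      (greatestBelow⇒beginsWith1⊎two (sat⇒greatestBelow u v sat))
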